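{- For all $n \geq 1$, the number of symplectic Dellac configurations of size $2n$ equals $\sum_{T \in \mathcal{T}_n} 2^{\mathrm{fr}(T)}$.
   Context: A Dellac configuration of size $m$ is a tableau with $m$ columns and $2m$ rows containing $2m$ dots such that every row contains exactly one dot, every column contains exactly two dots, and whenever there is a dot in the box $(j,i)$ (the intersection of the $j$-th column from the left and the $i$-th row from the bottom), one has $j \leq i \leq j+m$. A symplectic Dellac configuration of size $2n$ is a Dellac configuration $S$ of size $2n$ such that for all $i \in \{1,\dots,4n\}$ and $j \in \{1,\dots,2n\}$, there is a dot in box $(j,i)$ of $S$ if and only if there is a dot in box $(2n+1-j,4n+1-i)$ of $S$. $\mathcal{T}_n$ denotes the set of tableaux $T$ with $n$ columns and $2n$ rows containing $2n$ dots such that every row contains exactly one dot, every column contains exactly two dots, and if there is a dot in box $(j,i)$ then $j \leq i$. A dot of $T \in \mathcal{T}_n$ located in a box $(j,i)$ with $i \geq 2n+1-j$ is called free, and $\mathrm{fr}(T)$ is the number of free dots of $T$. -}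

module Defs where

open import Data.Nat using (ℕ; zero; suc; _+_; _*_; _^_; _≤_; _≤?_)
open import Data.Nat.Properties using (_≟_)
open import Data.Fin using (Fin; toℕ; opposite)
import Data.Fin.Properties as FinP
open import Data.Vec using (Vec; []; _∷_; lookup; count)
open import Data.List using (List; []; _∷_; map; concatMap; filter; length; allFin)
open import Data.Nat.ListAction using (sum)
open import Data.Product using (_×_; _,_)
open import Relation.Binary.PropositionalEquality using (_≡_)
open import Relation.Nullary using (Dec; _×-dec_; _→-dec_)

-- A tableau with m columns and k rows in which every row contains exactly one
-- dot is encoded by the vector  row ↦ column of its dot.
-- Rows and columns are 0-indexed here: Fin-row r is row i = r+1 (from the
-- bottom), Fin-column c is column j = c+1 (from the left).
Tableau : ℕ → ℕ → Set
Tableau m k = Vec (Fin m) k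

colCount : ∀ {m k} → Tableau m k → Fin m → ℕ
colCount t c = count (FinP._≟ c) t

allTableaux : ∀ m k → List (Tableau m k)
allTableaux m zero    = [] ∷ []
allTableaux m (suc k) = concatMap (λ c → map (c ∷_) (allTableaux m k)) (allFin m)

IsDellac : ∀ m → Tableau m (2 * m) → Set
IsDellac m t =
  (∀ c → colCount t c ≡ 2) ×
  (∀ r → (toℕ (lookup t r) ≤ toℕ r) × (toℕ r ≤ toℕ (lookup t r) + m))

-- symplectic condition for size 2n: dot in (j,i) iff dot in (2n+1-j, 4n+1-i)
-- (opposite r = 4n-1-r on Fin (4n), opposite c = 2n-1-c on Fin (2n)).
IsSymplecticDellac : ∀ n → Tableau (2 * n) (2 * (2 * n)) → Set
IsSymplecticDellac n t =
  IsDellac (2 * n) t ×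
  (∀ r c → ((lookup t r ≡ c) → (lookup t (opposite r) ≡ opposite c)) ×
           ((lookup t (opposite r) ≡ opposite c) → (lookup t r ≡ c)))

InT : ∀ n → Tableau n (2 * n) → Set
InT n t = (∀ c → colCount t c ≡ 2) × (∀ r → toℕ (lookup t r) ≤ toℕ r)

-- free dot in (j,i): i ≥ 2n+1-j, i.e. (r+1) + (c+1) ≥ 2n+1
IsFree : ∀ n → Tableau n (2 * n) → Fin (2 * n) → Set
IsFree n t r = 2 * n ≤ suc (toℕ r + toℕ (lookup t r))

fr : ∀ n → Tableau n (2 * n) → ℕ
fr n t = length (filter (λ r → 2 * n ≤? suc (toℕ r + toℕ (lookup t r))) (allFin (2 * n)))

colCount? : ∀ {m k} (t : Tableau m k) → Dec (∀ c → colCount t c ≡ 2)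
colCount? t = FinP.all? (λ c → colCount t c ≟ 2)

isDellac? : ∀ m (t : Tableau m (2 * m)) → Dec (IsDellac m t)
isDellac? m t = colCount? t ×-dec
  FinP.all? (λ r → (toℕ (lookup t r) ≤? toℕ r) ×-dec (toℕ r ≤? toℕ (lookup t r) + m))

isSymplecticDellac? : ∀ n (t : Tableau (2 * n) (2 * (2 * n))) → Dec (IsSymplecticDellac n t)
isSymplecticDellac? n t = isDellac? (2 * n) t ×-dec
  FinP.all? (λ r → FinP.all? (λ c →
    ((lookup t r FinP.≟ c) →-dec (lookup t (opposite r) FinP.≟ opposite c)) ×-dec
    ((lookup t (opposite r) FinP.≟ opposite c) →-dec (lookup t r FinP.≟ c))))

inT? : ∀ n (t : Tableau n (2 * n)) → Dec (InT n t)
inT? n t = colCount? t ×-dec FinP.all? (λ r → toℕ (lookup t r) ≤? toℕ r)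

numSymplecticDellac : ℕ → ℕ
numSymplecticDellac n = length (filter (isSymplecticDellac? n) (allTableaux (2 * n) (2 * (2 * n))))

𝒯 : ∀ n → List (Tableau n (2 * n))
𝒯 n = filter (inT? n) (allTableaux n (2 * n))

weightedSumT : ℕ → ℕ
weightedSumT n = sum (map (λ t → 2 ^ fr n t) (𝒯 n))

module Submission where

-- Both sides are written as sums of indicators over all tableaux (with one dot
-- per row), and the left-hand sum is transformed in two steps.
--
-- 1. Lower halves.  A symmetric configuration with a columns and 2a rows is
--    determined by its bottom a rows u (the top rows are the mirror image of
--    u), and u ++ mirror u is a symmetric Dellac configuration iff every dot
--    of u is weakly below the diagonal and each column of u together with its
--    mirror column holds two dots.
-- 2. Folding.  Folding the 2n columns of such a lower half in the middle
--    gives a tableau f with n columns together with a side b ∈ {0,1} for every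
--    row.  The pair condition becomes "f has two dots per column", and a dot
--    (x, r) of f unfolds below the diagonal on 1 + [the dot is free] sides
--    when x ≤ r, on none otherwise.  Summing over the sides row by row (sums of
--    products are products of sums) yields the weight 2^fr(f) on 𝒯_n.

open import Defs
open import Data.Nat using (ℕ; zero; suc; _+_; _*_; _^_; _∸_; _≤_; _<_; _≤?_)
open import Data.Nat.Properties renaming (_≟_ to _≟ℕ_)
open import Data.Nat.ListAction using (sum)
open import Data.Nat.ListAction.Properties using (sum-++)
open import Data.Fin using (Fin; toℕ; opposite; _↑ˡ_; _↑ʳ_; splitAt)
  renaming (zero to fzero; suc to fsuc)
open import Data.Fin.Patterns using (0F; 1F)
open import Data.Fin.Permutation using (reverse)
import Data.Fin.Properties as FinP
open FinP using (_≟_; opposite-involutive; opposite-prop; toℕ-↑ˡ; toℕ-↑ʳ; toℕ<n)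
open import Data.Vec using (Vec; []; _∷_; lookup; _++_; tabulate; zipWith)
import Data.Vec.Properties as VecP
open import Data.List using (List; []; _∷_; map; concatMap; filter; length; allFin)
import Data.List as List
import Data.List.Properties as ListP
open import Data.Product using (_×_; _,_; proj₁; proj₂; Σ-syntax)
open import Data.Sum using (_⊎_; inj₁; inj₂)
open import Function using (_∘_; id)
open import Relation.Binary.PropositionalEquality
open ≡-Reasoning
open import Relation.Nullary using (Dec; yes; no; ¬_; _×-dec_; contradiction)
open import Algebra.Properties.CommutativeSemigroup +-commutativeSemigroup using (interchange)
open import Algebra.Properties.Semiring.Sum +-*-semiring
  using (sum-syntax; sum-cong-≗; sum-replicate-zero; ∑-distrib-+; ∑-comm; ∑-permute;
         *-distribˡ-sum; *-distribʳ-sum)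
  renaming (sum to ∑)
open import Algebra.Properties.CommutativeMonoid.Sum *-1-commutativeMonoid
  using () renaming (sum to ∏; sum-cong-≗ to ∏-cong; ∑-distrib-+ to ∏-distrib-*)

private variable
  A P Q R : Set

∏-syntax : ∀ n → (Fin n → ℕ) → ℕ
∏-syntax _ = ∏

infixl 10 ∏-syntax

syntax ∏-syntax n (λ i → x) = ∏[ i < n ] x

-- Indicators

-- 𝟙 d is 1 or 0 according as the decided proposition holds.  Counting through
-- 𝟙 turns filters into sums and conjunctions into products.
𝟙 : Dec P → ℕ
𝟙 (yes _) = 1
𝟙 (no _)  = 0

𝟙-yes : P → (d : Dec P) → 𝟙 d ≡ 1
𝟙-yes p (yes _) = refl
𝟙-yes p (no ¬p) = contradiction p ¬p

𝟙-no : ¬ P → (d : Dec P) → 𝟙 d ≡ 0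
𝟙-no ¬p (yes p) = contradiction p ¬p
𝟙-no ¬p (no _)  = refl

𝟙-⇔ : (P → Q) → (Q → P) → (d : Dec P) (e : Dec Q) → 𝟙 d ≡ 𝟙 e
𝟙-⇔ to from (yes p) e = sym (𝟙-yes (to p) e)
𝟙-⇔ to from (no ¬p) e = sym (𝟙-no (¬p ∘ from) e)

𝟙-× : (d : Dec P) (e : Dec Q) (f : Dec (P × Q)) → 𝟙 f ≡ 𝟙 d * 𝟙 e
𝟙-× (yes p) (yes q) f = 𝟙-yes (p , q) f
𝟙-× (yes p) (no ¬q) f = 𝟙-no (¬q ∘ proj₂) f
𝟙-× (no ¬p) e       f = 𝟙-no (¬p ∘ proj₁) f

𝟙-∀ : ∀ k {P : Fin k → Set} (P? : ∀ r → Dec (P r)) (d : Dec (∀ r → P r)) →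
      𝟙 d ≡ ∏[ r < k ] 𝟙 (P? r)
𝟙-∀ zero    P? d = 𝟙-yes (λ ()) d
𝟙-∀ (suc k) {P} P? d = begin
  𝟙 d                                     ≡⟨ 𝟙-⇔ split join d (P? 0F ×-dec FinP.all? (P? ∘ fsuc)) ⟩
  𝟙 (P? 0F ×-dec FinP.all? (P? ∘ fsuc))   ≡⟨ 𝟙-× (P? 0F) (FinP.all? (P? ∘ fsuc)) _ ⟩
  𝟙 (P? 0F) * 𝟙 (FinP.all? (P? ∘ fsuc))  ≡⟨ cong (𝟙 (P? 0F) *_) (𝟙-∀ k (P? ∘ fsuc) _) ⟩
  𝟙 (P? 0F) * ∏[ r < k ] 𝟙 (P? (fsuc r)) ∎
  where
  split : (∀ r → P r) → P 0F × (∀ r → P (fsuc r))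
  split ∀P = ∀P 0F , ∀P ∘ fsuc
  join : P 0F × (∀ r → P (fsuc r)) → ∀ r → P r
  join (p₀ , _)  fzero    = p₀
  join (_  , ps) (fsuc r) = ps r

-- If A ⇔ Q and Q implies R, then 𝟙R + 𝟙A = 𝟙R · 2^𝟙Q (used for the two sides of a folded dot).
𝟙-+-⇔ : (A → Q) → (Q → A) → (Q → R) → (a : Dec A) (q : Dec Q) (c : Dec R) →
        𝟙 c + 𝟙 a ≡ 𝟙 c * 2 ^ 𝟙 q
𝟙-+-⇔ to from q⇒r a q c rewrite 𝟙-⇔ to from a q = go q c
  where
  go : (q : Dec _) (c : Dec _) → 𝟙 c + 𝟙 q ≡ 𝟙 c * 2 ^ 𝟙 q
  go (yes _) (yes _) = refl
  go (yes q) (no ¬c) = contradiction (q⇒r q) ¬c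
  go (no _)  (yes _) = refl
  go (no _)  (no _)  = refl

∑-pointMass : ∀ {m} (h : Fin m → ℕ) (c : Fin m) → (∀ i → i ≢ c → h i ≡ 0) → ∑ h ≡ h c
∑-pointMass {suc m} h fzero vanish = begin
  h 0F + ∑ (h ∘ fsuc) ≡⟨ cong (h 0F +_) (trans (sum-cong-≗ (λ i → vanish (fsuc i) λ ()))
                                                (sum-replicate-zero m)) ⟩
  h 0F + 0            ≡⟨ +-identityʳ (h 0F) ⟩
  h 0F                ∎
∑-pointMass {suc m} h (fsuc c) vanish = begin
  h 0F + ∑ (h ∘ fsuc) ≡⟨ cong (_+ ∑ (h ∘ fsuc)) (vanish 0F λ ()) ⟩
  ∑ (h ∘ fsuc)        ≡⟨ ∑-pointMass (h ∘ fsuc) c (λ i i≢c → vanish (fsuc i) (i≢c ∘ FinP.suc-injective)) ⟩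
  h (fsuc c)          ∎

∑-++ : ∀ a {b} (h : Fin (a + b) → ℕ) → ∑ h ≡ ∑[ i < a ] h (i ↑ˡ b) + ∑[ j < b ] h (a ↑ʳ j)
∑-++ zero    h = refl
∑-++ (suc a) h = trans (cong (h 0F +_) (∑-++ a (h ∘ fsuc))) (sym (+-assoc (h 0F) _ _))

∏-^ : ∀ b {m} (e : Fin m → ℕ) → ∏[ i < m ] (b ^ e i) ≡ b ^ ∑ e
∏-^ b {zero}  e = refl
∏-^ b {suc m} e = trans (cong (b ^ e 0F *_) (∏-^ b (e ∘ fsuc))) (sym (^-distribˡ-+-* b (e 0F) _))

opposite-injective : ∀ {m} {x y : Fin m} → opposite x ≡ opposite y → x ≡ y
opposite-injective {x = x} {y} e =
  trans (sym (opposite-involutive x)) (trans (cong opposite e) (opposite-involutive y))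

opposite-↑ˡ : ∀ {a} (i : Fin a) → opposite (i ↑ˡ a) ≡ a ↑ʳ opposite i
opposite-↑ˡ {a} i = FinP.toℕ-injective (begin
  toℕ (opposite (i ↑ˡ a))      ≡⟨ opposite-prop (i ↑ˡ a) ⟩
  (a + a) ∸ suc (toℕ (i ↑ˡ a)) ≡⟨ cong (λ z → (a + a) ∸ suc z) (toℕ-↑ˡ i a) ⟩
  (a + a) ∸ suc (toℕ i)        ≡⟨ +-∸-assoc a (toℕ<n i) ⟩
  a + (a ∸ suc (toℕ i))        ≡⟨ cong (a +_) (opposite-prop i) ⟨
  a + toℕ (opposite i)         ≡⟨ toℕ-↑ʳ a (opposite i) ⟨
  toℕ (a ↑ʳ opposite i)        ∎)

opposite-↑ʳ : ∀ {a} (j : Fin a) → opposite (a ↑ʳ j) ≡ opposite j ↑ˡ a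
opposite-↑ʳ {a} j = begin
  opposite (a ↑ʳ j)                       ≡⟨ cong (λ z → opposite (a ↑ʳ z)) (opposite-involutive j) ⟨
  opposite (a ↑ʳ opposite (opposite j))   ≡⟨ cong opposite (opposite-↑ˡ (opposite j)) ⟨
  opposite (opposite (opposite j ↑ˡ a))   ≡⟨ opposite-involutive _ ⟩
  opposite j ↑ˡ a                         ∎

block : ∀ a {b} (r : Fin (a + b)) → (Σ[ i ∈ Fin a ] i ↑ˡ b ≡ r) ⊎ (Σ[ j ∈ Fin b ] a ↑ʳ j ≡ r)
block a r with splitAt a r in eq
... | inj₁ i = inj₁ (i , FinP.splitAt⁻¹-↑ˡ eq)
... | inj₂ j = inj₂ (j , FinP.splitAt⁻¹-↑ʳ eq)

↑ˡ≢↑ʳ : ∀ {a b} (i : Fin a) (j : Fin b) → i ↑ˡ b ≢ a ↑ʳ j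
↑ˡ≢↑ʳ {a} {b} i j e
  with () ← trans (sym (FinP.splitAt-↑ˡ a i b)) (trans (cong (splitAt a) e) (FinP.splitAt-↑ʳ a b j))

colCount-∷ : ∀ {M k} (x : Fin M) (u : Tableau M k) c → colCount (x ∷ u) c ≡ 𝟙 (x ≟ c) + colCount u c
colCount-∷ x u c with x ≟ c
... | yes _ = refl
... | no _  = refl

colCount-∑ : ∀ {M k} (u : Tableau M k) c → colCount u c ≡ ∑[ r < k ] 𝟙 (lookup u r ≟ c)
colCount-∑ []      c = refl
colCount-∑ (x ∷ u) c = trans (colCount-∷ x u c) (cong (𝟙 (x ≟ c) +_) (colCount-∑ u c))

colCount-++ : ∀ {M k l} (u : Tableau M k) (v : Tableau M l) c →
              colCount (u ++ v) c ≡ colCount u c + colCount v c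
colCount-++ []      v c = refl
colCount-++ (x ∷ u) v c = begin
  colCount (x ∷ u ++ v) c                          ≡⟨ colCount-∷ x (u ++ v) c ⟩
  𝟙 (x ≟ c) + colCount (u ++ v) c                  ≡⟨ cong (𝟙 (x ≟ c) +_) (colCount-++ u v c) ⟩
  𝟙 (x ≟ c) + (colCount u c + colCount v c)        ≡⟨ +-assoc (𝟙 (x ≟ c)) _ _ ⟨
  (𝟙 (x ≟ c) + colCount u c) + colCount v c        ≡⟨ cong (_+ colCount v c) (colCount-∷ x u c) ⟨
  colCount (x ∷ u) c + colCount v c                ∎

-- Sums over all tableaux

∑T : ∀ M k → (Tableau M k → ℕ) → ℕ
∑T M zero    g = g []
∑T M (suc k) g = ∑[ c < M ] ∑T M k (λ t → g (c ∷ t))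

∑T-cong : ∀ {M} k {g h : Tableau M k → ℕ} → (∀ t → g t ≡ h t) → ∑T M k g ≡ ∑T M k h
∑T-cong zero    e = e []
∑T-cong (suc k) e = sum-cong-≗ (λ c → ∑T-cong k (λ t → e (c ∷ t)))

∑T-*ˡ : ∀ {M} k a (g : Tableau M k → ℕ) → ∑T M k (λ t → a * g t) ≡ a * ∑T M k g
∑T-*ˡ zero    a g = refl
∑T-*ˡ {M} (suc k) a g =
  trans (sum-cong-≗ (λ c → ∑T-*ˡ k a (λ t → g (c ∷ t))))
        (sym (*-distribˡ-sum a (λ c → ∑T M k (λ t → g (c ∷ t)))))

∑T-pointMass : ∀ {M} k (g : Tableau M k → ℕ) v → (∀ t → t ≢ v → g t ≡ 0) → ∑T M k g ≡ g v
∑T-pointMass zero    g [] vanish = refl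
∑T-pointMass (suc k) g (x ∷ v) vanish = begin
  ∑[ c < _ ] ∑T _ k (λ t → g (c ∷ t))
    ≡⟨ sum-cong-≗ (λ c → ∑T-pointMass k _ v (λ t t≢v → vanish (c ∷ t) (t≢v ∘ VecP.∷-injectiveʳ))) ⟩
  ∑[ c < _ ] g (c ∷ v)
    ≡⟨ ∑-pointMass _ x (λ c c≢x → vanish (c ∷ v) (c≢x ∘ VecP.∷-injectiveˡ)) ⟩
  g (x ∷ v) ∎

∑T-++ : ∀ {M} a {b} (g : Tableau M (a + b) → ℕ) →
        ∑T M (a + b) g ≡ ∑T M a (λ u → ∑T M b (λ v → g (u ++ v)))
∑T-++ zero    g = refl
∑T-++ (suc a) g = sum-cong-≗ (λ c → ∑T-++ a (λ t → g (c ∷ t)))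

∑T-∑ : ∀ {M} k {m} (F : Tableau M k → Fin m → ℕ) →
       ∑T M k (λ t → ∑ (F t)) ≡ ∑[ i < m ] ∑T M k (λ t → F t i)
∑T-∑ zero    F = refl
∑T-∑ (suc k) F = trans (sum-cong-≗ (λ c → ∑T-∑ k (λ t → F (c ∷ t))))
                       (∑-comm (λ c i → ∑T _ k (λ t → F (c ∷ t) i)))

∑T-∏ : ∀ {M} k (h : Fin k → Fin M → ℕ) →
       ∑T M k (λ t → ∏[ r < k ] h r (lookup t r)) ≡ ∏[ r < k ] ∑[ c < M ] h r c
∑T-∏ zero    h = refl
∑T-∏ (suc k) h = begin
  ∑[ c < _ ] ∑T _ k (λ t → h 0F c * ∏[ r < k ] h (fsuc r) (lookup t r))
    ≡⟨ sum-cong-≗ (λ c → ∑T-*ˡ k (h 0F c) _) ⟩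
  ∑[ c < _ ] (h 0F c * ∑T _ k (λ t → ∏[ r < k ] h (fsuc r) (lookup t r)))
    ≡⟨ sum-cong-≗ (λ c → cong (h 0F c *_) (∑T-∏ k (h ∘ fsuc))) ⟩
  ∑[ c < _ ] (h 0F c * ∏[ r < k ] ∑[ c′ < _ ] h (fsuc r) c′)
    ≡⟨ *-distribʳ-sum _ (h 0F) ⟨
  ∑[ c < _ ] h 0F c * ∏[ r < k ] ∑[ c′ < _ ] h (fsuc r) c′ ∎

-- Reindexing the columns: if φ : Fin a → Fin b → Fin m enumerates Fin m, then a
-- tableau with m columns is the same as a pair of tableaux with a and b columns
-- combined entrywise by φ.
∑T-reindex : ∀ {a b m} (φ : Fin a → Fin b → Fin m) →
             (∀ H → ∑ H ≡ ∑[ x < a ] ∑[ y < b ] H (φ x y)) →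
             ∀ k (g : Tableau m k → ℕ) →
             ∑T m k g ≡ ∑T a k (λ f → ∑T b k (λ s → g (zipWith φ f s)))
∑T-reindex φ enum zero    g = refl
∑T-reindex {a} {b} {m} φ enum (suc k) g = begin
  ∑[ c < m ] ∑T m k (λ t → g (c ∷ t))
    ≡⟨ sum-cong-≗ (λ c → ∑T-reindex φ enum k (λ t → g (c ∷ t))) ⟩
  ∑[ c < m ] ∑T a k (λ f → ∑T b k (λ s → g (c ∷ zipWith φ f s)))
    ≡⟨ enum _ ⟩
  ∑[ x < a ] ∑[ y < b ] ∑T a k (λ f → ∑T b k (λ s → g (φ x y ∷ zipWith φ f s)))
    ≡⟨ sum-cong-≗ (λ x → ∑T-∑ k (λ f y → ∑T b k (λ s → g (φ x y ∷ zipWith φ f s)))) ⟨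
  ∑[ x < a ] ∑T a k (λ f → ∑[ y < b ] ∑T b k (λ s → g (φ x y ∷ zipWith φ f s))) ∎

sum-map-++ : ∀ (g : A → ℕ) xs ys → sum (map g (xs List.++ ys)) ≡ sum (map g xs) + sum (map g ys)
sum-map-++ g xs ys = trans (cong sum (ListP.map-++ g xs ys)) (sum-++ (map g xs) (map g ys))

sum-map-concatMap : ∀ {B : Set} (g : B → ℕ) (F : A → List B) xs →
                    sum (map g (concatMap F xs)) ≡ sum (map (λ x → sum (map g (F x))) xs)
sum-map-concatMap g F []       = refl
sum-map-concatMap g F (x ∷ xs) =
  trans (sum-map-++ g (F x) _) (cong (sum (map g (F x)) +_) (sum-map-concatMap g F xs))

sum-map-allFin : ∀ m (h : Fin m → ℕ) → sum (map h (allFin m)) ≡ ∑ h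
sum-map-allFin m h = go m id
  where
  go : ∀ k (f : Fin k → Fin m) → sum (map h (List.tabulate f)) ≡ ∑ (h ∘ f)
  go zero    f = refl
  go (suc k) f = cong (h (f 0F) +_) (go k (f ∘ fsuc))

sum-map-allTableaux : ∀ M k (g : Tableau M k → ℕ) → sum (map g (allTableaux M k)) ≡ ∑T M k g
sum-map-allTableaux M zero    g = +-identityʳ (g [])
sum-map-allTableaux M (suc k) g = begin
  sum (map g (concatMap (λ c → map (c ∷_) (allTableaux M k)) (allFin M)))
    ≡⟨ sum-map-concatMap g _ (allFin M) ⟩
  sum (map (λ c → sum (map g (map (c ∷_) (allTableaux M k)))) (allFin M))
    ≡⟨ sum-map-allFin M _ ⟩
  ∑[ c < M ] sum (map g (map (c ∷_) (allTableaux M k)))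
    ≡⟨ sum-cong-≗ (λ c → cong sum (ListP.map-∘ {g = g} {f = c ∷_} (allTableaux M k))) ⟨
  ∑[ c < M ] sum (map (λ t → g (c ∷ t)) (allTableaux M k))
    ≡⟨ sum-cong-≗ (λ c → sum-map-allTableaux M k (λ t → g (c ∷ t))) ⟩
  ∑[ c < M ] ∑T M k (λ t → g (c ∷ t)) ∎

sum-map-filter : ∀ {P : A → Set} (P? : ∀ x → Dec (P x)) (g : A → ℕ) xs →
                 sum (map g (filter P? xs)) ≡ sum (map (λ x → 𝟙 (P? x) * g x) xs)
sum-map-filter P? g [] = refl
sum-map-filter P? g (x ∷ xs) with P? x
... | yes _ = cong₂ _+_ (sym (+-identityʳ (g x))) (sum-map-filter P? g xs)
... | no _  = sum-map-filter P? g xs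

length-filter : ∀ {P : A → Set} (P? : ∀ x → Dec (P x)) xs →
                length (filter P? xs) ≡ sum (map (𝟙 ∘ P?) xs)
length-filter P? [] = refl
length-filter P? (x ∷ xs) with P? x
... | yes _ = cong suc (length-filter P? xs)
... | no _  = length-filter P? xs

length-filter-allTableaux : ∀ M k {P : Tableau M k → Set} (P? : ∀ t → Dec (P t)) →
                            length (filter P? (allTableaux M k)) ≡ ∑T M k (𝟙 ∘ P?)
length-filter-allTableaux M k P? =
  trans (length-filter P? (allTableaux M k)) (sum-map-allTableaux M k _)

sum-filter-allTableaux : ∀ M k {P : Tableau M k → Set} (P? : ∀ t → Dec (P t)) (g : Tableau M k → ℕ) →
                         sum (map g (filter P? (allTableaux M k))) ≡ ∑T M k (λ t → 𝟙 (P? t) * g t)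
sum-filter-allTableaux M k P? g =
  trans (sum-map-filter P? g (allTableaux M k)) (sum-map-allTableaux M k _)

-- Step 1: symmetric Dellac configurations and their lower halves

IsDellacShaped : ∀ m N → Tableau m N → Set
IsDellacShaped m N t =
  (∀ c → colCount t c ≡ 2) × (∀ r → (toℕ (lookup t r) ≤ toℕ r) × (toℕ r ≤ toℕ (lookup t r) + m))

IsSymmetric : ∀ {m N} → Tableau m N → Set
IsSymmetric t =
  ∀ r c → ((lookup t r ≡ c) → (lookup t (opposite r) ≡ opposite c)) ×
          ((lookup t (opposite r) ≡ opposite c) → (lookup t r ≡ c))

-- Symmetric Dellac configurations of any size; IsSymplecticDellac n is, by
-- definition, the case m = 2n, N = 4n.
IsSymmetricDellac : ∀ m N → Tableau m N → Set
IsSymmetricDellac m N t = IsDellacShaped m N t × IsSymmetric t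

IsCentrallySymmetric : ∀ {m N} → Tableau m N → Set
IsCentrallySymmetric t = ∀ r → lookup t (opposite r) ≡ opposite (lookup t r)

symmetric⇒central : ∀ {m N} {t : Tableau m N} → IsSymmetric t → IsCentrallySymmetric t
symmetric⇒central S r = proj₁ (S r _) refl

central⇒symmetric : ∀ {m N} {t : Tableau m N} → IsCentrallySymmetric t → IsSymmetric t
central⇒symmetric C r c =
  (λ e → trans (C r) (cong opposite e)) , (λ e → opposite-injective (trans (sym (C r)) e))

IsLowerHalf : ∀ M k → Tableau M k → Set
IsLowerHalf M k u =
  (∀ r → toℕ (lookup u r) ≤ toℕ r) × (∀ c → colCount u c + colCount u (opposite c) ≡ 2)

isLowerHalf? : ∀ M k (u : Tableau M k) → Dec (IsLowerHalf M k u)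
isLowerHalf? M k u =
  FinP.all? (λ r → toℕ (lookup u r) ≤? toℕ r) ×-dec
  FinP.all? (λ c → colCount u c + colCount u (opposite c) ≟ℕ 2)

-- The top half forced by the symmetry on a given bottom half.
mirror : ∀ {a} → Tableau a a → Tableau a a
mirror u = tabulate (λ r → opposite (lookup u (opposite r)))

lookup-mirror : ∀ {a} (u : Tableau a a) r → lookup (mirror u) r ≡ opposite (lookup u (opposite r))
lookup-mirror u r = VecP.lookup∘tabulate _ r

colCount-mirror : ∀ {a} (u : Tableau a a) c → colCount (mirror u) c ≡ colCount u (opposite c)
colCount-mirror {a} u c = begin
  colCount (mirror u) c                              ≡⟨ colCount-∑ (mirror u) c ⟩
  ∑[ r < a ] 𝟙 (lookup (mirror u) r ≟ c)             ≡⟨ sum-cong-≗ (λ r → 𝟙-⇔ (to r) (from r) _ _) ⟩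
  ∑[ r < a ] 𝟙 (lookup u (opposite r) ≟ opposite c)  ≡⟨ ∑-permute (λ r → 𝟙 (lookup u r ≟ opposite c)) reverse ⟨
  ∑[ r < a ] 𝟙 (lookup u r ≟ opposite c)             ≡⟨ colCount-∑ u (opposite c) ⟨
  colCount u (opposite c)                            ∎
  where
  to : ∀ r → lookup (mirror u) r ≡ c → lookup u (opposite r) ≡ opposite c
  to r e = trans (sym (opposite-involutive _)) (cong opposite (trans (sym (lookup-mirror u r)) e))
  from : ∀ r → lookup u (opposite r) ≡ opposite c → lookup (mirror u) r ≡ c
  from r e = trans (lookup-mirror u r) (trans (cong opposite e) (opposite-involutive c))

colCount-mirrored : ∀ {a} (u : Tableau a a) c →
                    colCount (u ++ mirror u) c ≡ colCount u c + colCount u (opposite c)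
colCount-mirrored u c = trans (colCount-++ u (mirror u) c) (cong (colCount u c +_) (colCount-mirror u c))

central⇒top≡mirror : ∀ {a} (u v : Tableau a a) → IsCentrallySymmetric (u ++ v) → v ≡ mirror u
central⇒top≡mirror {a} u v C = trans (sym (VecP.tabulate∘lookup v)) (VecP.tabulate-cong (λ j → begin
  lookup v j                                      ≡⟨ VecP.lookup-++ʳ u v j ⟨
  lookup (u ++ v) (a ↑ʳ j)                        ≡⟨ cong (λ z → lookup (u ++ v) (a ↑ʳ z)) (opposite-involutive j) ⟨
  lookup (u ++ v) (a ↑ʳ opposite (opposite j))    ≡⟨ cong (lookup (u ++ v)) (opposite-↑ˡ (opposite j)) ⟨
  lookup (u ++ v) (opposite (opposite j ↑ˡ a))    ≡⟨ C (opposite j ↑ˡ a) ⟩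
  opposite (lookup (u ++ v) (opposite j ↑ˡ a))    ≡⟨ cong opposite (VecP.lookup-++ˡ u v (opposite j)) ⟩
  opposite (lookup u (opposite j))                ∎))

mirrored-central : ∀ {a} (u : Tableau a a) → IsCentrallySymmetric (u ++ mirror u)
mirrored-central {a} u r with block a r
... | inj₁ (i , refl) = begin
  lookup (u ++ mirror u) (opposite (i ↑ˡ a))  ≡⟨ cong (lookup (u ++ mirror u)) (opposite-↑ˡ i) ⟩
  lookup (u ++ mirror u) (a ↑ʳ opposite i)    ≡⟨ VecP.lookup-++ʳ u (mirror u) (opposite i) ⟩
  lookup (mirror u) (opposite i)              ≡⟨ lookup-mirror u (opposite i) ⟩
  opposite (lookup u (opposite (opposite i))) ≡⟨ cong (opposite ∘ lookup u) (opposite-involutive i) ⟩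
  opposite (lookup u i)                       ≡⟨ cong opposite (VecP.lookup-++ˡ u (mirror u) i) ⟨
  opposite (lookup (u ++ mirror u) (i ↑ˡ a))  ∎
... | inj₂ (j , refl) = begin
  lookup (u ++ mirror u) (opposite (a ↑ʳ j))  ≡⟨ cong (lookup (u ++ mirror u)) (opposite-↑ʳ j) ⟩
  lookup (u ++ mirror u) (opposite j ↑ˡ a)    ≡⟨ VecP.lookup-++ˡ u (mirror u) (opposite j) ⟩
  lookup u (opposite j)                       ≡⟨ opposite-involutive _ ⟨
  opposite (opposite (lookup u (opposite j))) ≡⟨ cong opposite (lookup-mirror u j) ⟨
  opposite (lookup (mirror u) j)              ≡⟨ cong opposite (VecP.lookup-++ʳ u (mirror u) j) ⟨
  opposite (lookup (u ++ mirror u) (a ↑ʳ j))  ∎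

∸-swap : ∀ {a j x} → j < a → x ≤ a ∸ suc j → j ≤ a ∸ suc x
∸-swap {a} {j} {x} j<a x≤ = m+n≤o⇒m≤o∸n j (subst (_≤ a) x+1+j≡j+1+x (m≤o∸n⇒m+n≤o x j<a x≤))
  where
  x+1+j≡j+1+x : x + suc j ≡ j + suc x
  x+1+j≡j+1+x = trans (+-suc x j) (trans (cong suc (+-comm x j)) (sym (+-suc j x)))

mirrored-rows : ∀ {a} (u : Tableau a a) → (∀ r → toℕ (lookup u r) ≤ toℕ r) →
  ∀ r → (toℕ (lookup (u ++ mirror u) r) ≤ toℕ r) × (toℕ r ≤ toℕ (lookup (u ++ mirror u) r) + a)
mirrored-rows {a} u below r with block a r
... | inj₁ (i , refl) rewrite VecP.lookup-++ˡ u (mirror u) i | toℕ-↑ˡ i a =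
  below i , ≤-trans (<⇒≤ (toℕ<n i)) (m≤n+m a _)
... | inj₂ (j , refl)
  rewrite VecP.lookup-++ʳ u (mirror u) j | toℕ-↑ʳ a j | lookup-mirror u j
        | opposite-prop (lookup u (opposite j)) =
  ≤-trans (m∸n≤m a (suc (toℕ (lookup u (opposite j))))) (m≤m+n a (toℕ j)) ,
  subst (a + toℕ j ≤_) (+-comm a _) (+-monoʳ-≤ a (∸-swap (toℕ<n j) below-opposite))
  where
  below-opposite : toℕ (lookup u (opposite j)) ≤ a ∸ suc (toℕ j)
  below-opposite = subst (toℕ (lookup u (opposite j)) ≤_) (opposite-prop j) (below (opposite j))

mirrored⇒lowerHalf : ∀ {a} (u : Tableau a a) → IsSymmetricDellac a (a + a) (u ++ mirror u) → IsLowerHalf a a u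
mirrored⇒lowerHalf {a} u ((counts , rows) , _) = below , pairs
  where
  below : ∀ r → toℕ (lookup u r) ≤ toℕ r
  below r = subst₂ _≤_ (cong toℕ (VecP.lookup-++ˡ u (mirror u) r)) (toℕ-↑ˡ r a) (proj₁ (rows (r ↑ˡ a)))
  pairs : ∀ c → colCount u c + colCount u (opposite c) ≡ 2
  pairs c = trans (sym (colCount-mirrored u c)) (counts c)

lowerHalf⇒mirrored : ∀ {a} (u : Tableau a a) → IsLowerHalf a a u → IsSymmetricDellac a (a + a) (u ++ mirror u)
lowerHalf⇒mirrored u (below , pairs) =
  ((λ c → trans (colCount-mirrored u c) (pairs c)) , mirrored-rows u below) ,
  central⇒symmetric {t = u ++ mirror u} (mirrored-central u)

-- The row count is given as a + b with b ≡ a so that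
-- it also covers 2 * a, which unfolds to a + (a + 0).
∑T-symmetricDellac : ∀ a {b} → b ≡ a → (P? : ∀ t → Dec (IsSymmetricDellac a (a + b) t)) →
                     ∑T a (a + b) (𝟙 ∘ P?) ≡ ∑T a a (𝟙 ∘ isLowerHalf? a a)
∑T-symmetricDellac a refl P? = begin
  ∑T a (a + a) (𝟙 ∘ P?)                           ≡⟨ ∑T-++ a (𝟙 ∘ P?) ⟩
  ∑T a a (λ u → ∑T a a (λ v → 𝟙 (P? (u ++ v))))   ≡⟨ ∑T-cong a topIsMirror ⟩
  ∑T a a (λ u → 𝟙 (P? (u ++ mirror u)))           ≡⟨ ∑T-cong a lowerHalf ⟩
  ∑T a a (𝟙 ∘ isLowerHalf? a a)                   ∎
  where
  lowerHalf : ∀ u → 𝟙 (P? (u ++ mirror u)) ≡ 𝟙 (isLowerHalf? a a u)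
  lowerHalf u = 𝟙-⇔ (mirrored⇒lowerHalf u) (lowerHalf⇒mirrored u) _ _
  topIsMirror : ∀ u → ∑T a a (λ v → 𝟙 (P? (u ++ v))) ≡ 𝟙 (P? (u ++ mirror u))
  topIsMirror u = ∑T-pointMass a _ (mirror u)
    (λ v v≢mirror → 𝟙-no (v≢mirror ∘ central⇒top≡mirror u v ∘ symmetric⇒central {t = u ++ v} ∘ proj₂) _)

-- Step 2: folding the columns of a lower half

-- Column x of the left half of Fin (n + n) and its mirror column both fold onto
-- column x of Fin n; unfold x b recovers them from x and a side b.
unfold : ∀ {n} → Fin n → Fin 2 → Fin (n + n)
unfold {n} x 0F = x ↑ˡ n
unfold {n} x 1F = opposite (x ↑ˡ n)

unfold-injective : ∀ {n} {x y : Fin n} b b′ → unfold x b ≡ unfold y b′ → x ≡ y × b ≡ b′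
unfold-injective {n} {x} {y} 0F 0F e = FinP.↑ˡ-injective n x y e , refl
unfold-injective {n} {x} {y} 1F 1F e = FinP.↑ˡ-injective n x y (opposite-injective e) , refl
unfold-injective {n} {x} {y} 0F 1F e = contradiction (trans e (opposite-↑ˡ y)) (↑ˡ≢↑ʳ x (opposite y))
unfold-injective {n} {x} {y} 1F 0F e = contradiction (trans (sym e) (opposite-↑ˡ x)) (↑ˡ≢↑ʳ y (opposite x))

unfold-surjective : ∀ {n} (c : Fin (n + n)) → Σ[ x ∈ Fin n ] Σ[ b ∈ Fin 2 ] unfold x b ≡ c
unfold-surjective {n} c with block n c
... | inj₁ (i , e) = i , 0F , e
... | inj₂ (j , e) = opposite j , 1F ,
  trans (opposite-↑ˡ (opposite j)) (trans (cong (n ↑ʳ_) (opposite-involutive j)) e)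

∑-unfold : ∀ {n} (H : Fin (n + n) → ℕ) → ∑ H ≡ ∑[ x < n ] ∑[ b < 2 ] H (unfold x b)
∑-unfold {n} H = begin
  ∑ H
    ≡⟨ ∑-++ n H ⟩
  ∑[ i < n ] H (i ↑ˡ n) + ∑[ j < n ] H (n ↑ʳ j)
    ≡⟨ cong (∑[ i < n ] H (i ↑ˡ n) +_) (∑-permute (λ j → H (n ↑ʳ j)) (reverse {n})) ⟩
  ∑[ i < n ] H (i ↑ˡ n) + ∑[ x < n ] H (n ↑ʳ opposite x)
    ≡⟨ cong (∑[ i < n ] H (i ↑ˡ n) +_) (sum-cong-≗ (λ x → cong H (opposite-↑ˡ {n} x))) ⟨
  ∑[ x < n ] H (unfold {n} x 0F) + ∑[ x < n ] H (unfold {n} x 1F)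
    ≡⟨ ∑-distrib-+ (λ x → H (unfold {n} x 0F)) (λ x → H (unfold {n} x 1F)) ⟨
  ∑[ x < n ] (H (unfold {n} x 0F) + H (unfold {n} x 1F))
    ≡⟨ sum-cong-≗ (λ x → cong (H (unfold {n} x 0F) +_) (+-identityʳ (H (unfold {n} x 1F)))) ⟨
  ∑[ x < n ] ∑[ b < 2 ] H (unfold {n} x b) ∎

unfold-pair : ∀ {n} (y : Fin n) b x → 𝟙 (unfold y b ≟ unfold x 0F) + 𝟙 (unfold y b ≟ unfold x 1F) ≡ 𝟙 (y ≟ x)
unfold-pair y b x with y ≟ x
unfold-pair y 0F .y | yes refl =
  cong₂ _+_ (𝟙-yes refl (unfold y 0F ≟ unfold y 0F))
            (𝟙-no ((λ ()) ∘ proj₂ ∘ unfold-injective 0F 1F) (unfold y 0F ≟ unfold y 1F))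
unfold-pair y 1F .y | yes refl =
  cong₂ _+_ (𝟙-no ((λ ()) ∘ proj₂ ∘ unfold-injective 1F 0F) (unfold y 1F ≟ unfold y 0F))
            (𝟙-yes refl (unfold y 1F ≟ unfold y 1F))
unfold-pair y b x | no y≢x =
  cong₂ _+_ (𝟙-no (y≢x ∘ proj₁ ∘ unfold-injective b 0F) (unfold y b ≟ unfold x 0F))
            (𝟙-no (y≢x ∘ proj₁ ∘ unfold-injective b 1F) (unfold y b ≟ unfold x 1F))

colCount-unfold : ∀ {n k} (f : Tableau n k) (s : Vec (Fin 2) k) x →
  colCount (zipWith unfold f s) (unfold x 0F) + colCount (zipWith unfold f s) (unfold x 1F) ≡ colCount f x
colCount-unfold []      []      x = refl
colCount-unfold (y ∷ f) (b ∷ s) x = begin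
  colCount (unfold y b ∷ t) (unfold x 0F) + colCount (unfold y b ∷ t) (unfold x 1F)
    ≡⟨ cong₂ _+_ (colCount-∷ (unfold y b) t (unfold x 0F)) (colCount-∷ (unfold y b) t (unfold x 1F)) ⟩
  (head₀ + rest₀) + (head₁ + rest₁)
    ≡⟨ interchange head₀ rest₀ head₁ rest₁ ⟩
  (head₀ + head₁) + (rest₀ + rest₁)
    ≡⟨ cong₂ _+_ (unfold-pair y b x) (colCount-unfold f s x) ⟩
  𝟙 (y ≟ x) + colCount f x
    ≡⟨ colCount-∷ y f x ⟨
  colCount (y ∷ f) x ∎
  where
  t = zipWith unfold f s
  head₀ = 𝟙 (unfold y b ≟ unfold x 0F)
  head₁ = 𝟙 (unfold y b ≟ unfold x 1F)
  rest₀ = colCount t (unfold x 0F)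
  rest₁ = colCount t (unfold x 1F)

unfolded-pairs⇒ : ∀ {n k} (f : Tableau n k) s →
  (∀ c → colCount (zipWith unfold f s) c + colCount (zipWith unfold f s) (opposite c) ≡ 2) →
  ∀ x → colCount f x ≡ 2
unfolded-pairs⇒ f s pairs x = trans (sym (colCount-unfold f s x)) (pairs (unfold x 0F))

unfolded-pairs⇐ : ∀ {n k} (f : Tableau n k) s → (∀ x → colCount f x ≡ 2) →
  ∀ c → colCount (zipWith unfold f s) c + colCount (zipWith unfold f s) (opposite c) ≡ 2
unfolded-pairs⇐ {n} f s two c with unfold-surjective {n} c
... | x , 0F , refl = trans (colCount-unfold f s x) (two x)
... | x , 1F , refl rewrite opposite-involutive (unfold x 0F) =
  trans (+-comm (colCount t (unfold x 1F)) (colCount t (unfold x 0F))) (trans (colCount-unfold f s x) (two x))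
  where
  t = zipWith unfold f s

lowerHalf-unfold : ∀ {n k} (f : Tableau n k) s →
  𝟙 (isLowerHalf? (n + n) k (zipWith unfold f s)) ≡
  𝟙 (colCount? f) * ∏[ r < k ] 𝟙 (toℕ (unfold (lookup f r) (lookup s r)) ≤? toℕ r)
lowerHalf-unfold {n} {k} f s = begin
  𝟙 (isLowerHalf? (n + n) k t)
    ≡⟨ 𝟙-× (FinP.all? below?) (FinP.all? pairs?) _ ⟩
  𝟙 (FinP.all? below?) * 𝟙 (FinP.all? pairs?)
    ≡⟨ *-comm (𝟙 (FinP.all? below?)) _ ⟩
  𝟙 (FinP.all? pairs?) * 𝟙 (FinP.all? below?)
    ≡⟨ cong₂ _*_ (𝟙-⇔ (unfolded-pairs⇒ f s) (unfolded-pairs⇐ f s) (FinP.all? pairs?) (colCount? f))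
                 (𝟙-∀ k below? (FinP.all? below?)) ⟩
  𝟙 (colCount? f) * ∏[ r < k ] 𝟙 (below? r)
    ≡⟨ cong (𝟙 (colCount? f) *_)
            (∏-cong (λ r → cong (λ c → 𝟙 (toℕ c ≤? toℕ r)) (VecP.lookup-zipWith unfold r f s))) ⟩
  𝟙 (colCount? f) * ∏[ r < k ] 𝟙 (toℕ (unfold (lookup f r) (lookup s r)) ≤? toℕ r) ∎
  where
  t = zipWith unfold f s
  below? : ∀ r → Dec (toℕ (lookup t r) ≤ toℕ r)
  below? r = toℕ (lookup t r) ≤? toℕ r
  pairs? : ∀ c → Dec (colCount t c + colCount t (opposite c) ≡ 2)
  pairs? c = colCount t c + colCount t (opposite c) ≟ℕ 2

rowWeight : ∀ {n} (x : Fin n) r →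
  ∑[ b < 2 ] 𝟙 (toℕ (unfold x b) ≤? r) ≡ 𝟙 (toℕ x ≤? r) * 2 ^ 𝟙 (n + n ≤? suc (r + toℕ x))
rowWeight {n} x r = begin
  𝟙 (toℕ (x ↑ˡ n) ≤? r) + (𝟙 (toℕ (opposite (x ↑ˡ n)) ≤? r) + 0)
    ≡⟨ cong₂ _+_ (𝟙-⇔ (subst (_≤ r) (toℕ-↑ˡ x n)) (subst (_≤ r) (sym (toℕ-↑ˡ x n)))
                      (toℕ (x ↑ˡ n) ≤? r) (X ≤? r))
                 (+-identityʳ (𝟙 (toℕ (opposite (x ↑ˡ n)) ≤? r))) ⟩
  𝟙 (X ≤? r) + 𝟙 (toℕ (opposite (x ↑ˡ n)) ≤? r)
    ≡⟨ 𝟙-+-⇔ mirror⇒free free⇒mirror free⇒below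
              (toℕ (opposite (x ↑ˡ n)) ≤? r) (n + n ≤? suc (r + X)) (X ≤? r) ⟩
  𝟙 (X ≤? r) * 2 ^ 𝟙 (n + n ≤? suc (r + X)) ∎
  where
  X = toℕ x
  toℕ-mirror : toℕ (opposite (x ↑ˡ n)) ≡ n + n ∸ suc X
  toℕ-mirror = trans (opposite-prop (x ↑ˡ n)) (cong (λ z → n + n ∸ suc z) (toℕ-↑ˡ x n))
  mirror⇒free : toℕ (opposite (x ↑ˡ n)) ≤ r → n + n ≤ suc (r + X)
  mirror⇒free h = subst (n + n ≤_) (cong suc (+-comm X r))
    (≤-trans (m≤n+m∸n (n + n) (suc X)) (+-monoʳ-≤ (suc X) (subst (_≤ r) toℕ-mirror h)))
  free⇒mirror : n + n ≤ suc (r + X) → toℕ (opposite (x ↑ˡ n)) ≤ r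
  free⇒mirror h = subst (_≤ r) (sym toℕ-mirror)
    (m≤n+o⇒m∸n≤o (n + n) (suc X) (subst (n + n ≤_) (cong suc (+-comm r X)) h))
  free⇒below : n + n ≤ suc (r + X) → X ≤ r
  free⇒below h = ≤-trans (<⇒≤ (toℕ<n x))
    (+-cancelʳ-≤ n n r (≤-trans h (subst (_≤ r + n) (+-suc r X) (+-monoʳ-≤ r (toℕ<n x)))))

-- The weight carried by a folded tableau f with n columns and k rows, m being the
-- width 2n of the unfolded tableaux.
foldedWeight : ∀ {n k} (m : ℕ) → Tableau n k → ℕ
foldedWeight {k = k} m f =
  𝟙 (colCount? f) * ∏[ r < k ] (𝟙 (toℕ (lookup f r) ≤? toℕ r) * 2 ^ 𝟙 (m ≤? suc (toℕ r + toℕ (lookup f r))))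

∑T-lowerHalf : ∀ {n m} → m ≡ n + n → ∀ k → ∑T m k (𝟙 ∘ isLowerHalf? m k) ≡ ∑T n k (foldedWeight m)
∑T-lowerHalf {n} refl k = begin
  ∑T (n + n) k (𝟙 ∘ isLowerHalf? (n + n) k)
    ≡⟨ ∑T-reindex (unfold {n}) (∑-unfold {n}) k (𝟙 ∘ isLowerHalf? (n + n) k) ⟩
  ∑T n k (λ f → ∑T 2 k (λ s → 𝟙 (isLowerHalf? (n + n) k (zipWith unfold f s))))
    ≡⟨ ∑T-cong k fibre ⟩
  ∑T n k (foldedWeight (n + n)) ∎
  where
  fibre : ∀ f → ∑T 2 k (λ s → 𝟙 (isLowerHalf? (n + n) k (zipWith unfold f s))) ≡ foldedWeight (n + n) f
  fibre f = begin
    ∑T 2 k (λ s → 𝟙 (isLowerHalf? (n + n) k (zipWith unfold f s)))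
      ≡⟨ ∑T-cong k (lowerHalf-unfold f) ⟩
    ∑T 2 k (λ s → 𝟙 (colCount? f) * ∏[ r < k ] h r (lookup s r))
      ≡⟨ ∑T-*ˡ k (𝟙 (colCount? f)) (λ s → ∏[ r < k ] h r (lookup s r)) ⟩
    𝟙 (colCount? f) * ∑T 2 k (λ s → ∏[ r < k ] h r (lookup s r))
      ≡⟨ cong (𝟙 (colCount? f) *_) (trans (∑T-∏ k h) (∏-cong (λ r → rowWeight (lookup f r) (toℕ r)))) ⟩
    foldedWeight (n + n) f ∎
    where
    h : Fin k → Fin 2 → ℕ
    h r b = 𝟙 (toℕ (unfold (lookup f r) b) ≤? toℕ r)

weight≡foldedWeight : ∀ n (t : Tableau n (2 * n)) → 𝟙 (inT? n t) * 2 ^ fr n t ≡ foldedWeight (2 * n) t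
weight≡foldedWeight n t = begin
  𝟙 (inT? n t) * 2 ^ fr n t
    ≡⟨ cong₂ (λ a e → a * 2 ^ e) (𝟙-× (colCount? t) (FinP.all? below?) (inT? n t)) freeDots ⟩
  𝟙 (colCount? t) * 𝟙 (FinP.all? below?) * 2 ^ ∑ (𝟙 ∘ free?)
    ≡⟨ *-assoc (𝟙 (colCount? t)) _ _ ⟩
  𝟙 (colCount? t) * (𝟙 (FinP.all? below?) * 2 ^ ∑ (𝟙 ∘ free?))
    ≡⟨ cong (𝟙 (colCount? t) *_) (cong₂ _*_ (𝟙-∀ k below? (FinP.all? below?)) (sym (∏-^ 2 (𝟙 ∘ free?)))) ⟩
  𝟙 (colCount? t) * (∏[ r < k ] 𝟙 (below? r) * ∏[ r < k ] (2 ^ 𝟙 (free? r)))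
    ≡⟨ cong (𝟙 (colCount? t) *_) (∏-distrib-* (𝟙 ∘ below?) (λ r → 2 ^ 𝟙 (free? r))) ⟨
  foldedWeight (2 * n) t ∎
  where
  k = 2 * n
  below? : ∀ r → Dec (toℕ (lookup t r) ≤ toℕ r)
  below? r = toℕ (lookup t r) ≤? toℕ r
  free? : ∀ r → Dec (k ≤ suc (toℕ r + toℕ (lookup t r)))
  free? r = k ≤? suc (toℕ r + toℕ (lookup t r))
  freeDots : fr n t ≡ ∑ (𝟙 ∘ free?)
  freeDots = trans (length-filter free? (allFin k)) (sum-map-allFin k (𝟙 ∘ free?))

proposition5 : (n : ℕ) → 1 ≤ n → numSymplecticDellac n ≡ weightedSumT n
proposition5 n _ = begin
  numSymplecticDellac n
    ≡⟨ length-filter-allTableaux (2 * n) (2 * (2 * n)) (isSymplecticDellac? n) ⟩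
  ∑T (2 * n) (2 * (2 * n)) (𝟙 ∘ isSymplecticDellac? n)
    ≡⟨ ∑T-symmetricDellac (2 * n) (+-identityʳ (2 * n)) (isSymplecticDellac? n) ⟩
  ∑T (2 * n) (2 * n) (𝟙 ∘ isLowerHalf? (2 * n) (2 * n))
    ≡⟨ ∑T-lowerHalf (cong (n +_) (+-identityʳ n)) (2 * n) ⟩
  ∑T n (2 * n) (foldedWeight (2 * n))
    ≡⟨ ∑T-cong (2 * n) (weight≡foldedWeight n) ⟨
  ∑T n (2 * n) (λ t → 𝟙 (inT? n t) * 2 ^ fr n t)
    ≡⟨ sum-filter-allTableaux n (2 * n) (inT? n) (λ t → 2 ^ fr n t) ⟨
  weightedSumT n ∎
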